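{- Let $n$ be a positive integer. Then the number of partitions of $n$ whose first part is at least three times the second part is $$p^{(3)}(n)=p(n)-p(n-2)-p(n-3)+p(n-5).$$
   Context: A partition of a positive integer $n$ is a finite sequence $\lambda=[\lambda_1,\ldots,\lambda_k]$ of positive integers with $\lambda_1\ge\cdots\ge\lambda_k$ summing to $n$. $p(n)$ is the number of partitions of $n$, with the conventions $p(0)=1$ and $p(k)=0$ for $k<0$. $p^{(3)}(n)$ denotes the number of partitions $\lambda$ of $n$ with $\lambda_1\ge 3\lambda_2$, where the one-part partition $[n]$ is considered to satisfy this condition. -}

module Defs where

open import Data.Nat using (ℕ; zero; suc; _≤_; _<_; _*_)
open import Data.Integer using (ℤ; +_; -[1+_])
open import Data.List using (List; []; _∷_)
open import Data.Nat.ListAction using (sum)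
open import Data.Unit using (⊤)
open import Data.List.Relation.Unary.All using (All)
open import Data.List.Relation.Unary.Linked using (Linked)
open import Data.Fin using (Fin)
open import Data.Product using (Σ; _×_)
open import Data.Empty using (⊥)
open import Relation.Binary.PropositionalEquality using (_≡_)
open import Function.Bundles using (_↔_)

IsPartition : ℕ → List ℕ → Set
IsPartition n l = All (λ x → 0 < x) l × Linked (λ a b → b ≤ a) l × sum l ≡ n

Partition : ℕ → Set
Partition n = Σ (List ℕ) (IsPartition n)

-- Partitions indexed by an integer: none for negative arguments
-- (so that p(k) = 0 for k < 0; p(0) = 1 via the empty partition).
Partitionℤ : ℤ → Set
Partitionℤ (+ n) = Partition n
Partitionℤ -[1+ _ ] = ⊥

-- λ₁ ≥ 3 λ₂ ; a partition with fewer than two parts satisfies it vacuously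
-- (for n ≥ 1 the only such partition is the one-part partition [n]).
FirstAtLeastThreeTimesSecond : List ℕ → Set
FirstAtLeastThreeTimesSecond (a ∷ b ∷ _) = 3 * b ≤ a
FirstAtLeastThreeTimesSecond _ = ⊤

Partition3 : ℕ → Set
Partition3 n = Σ (List ℕ) (λ l → IsPartition n l × FirstAtLeastThreeTimesSecond l)

HasCard : Set → ℕ → Set
HasCard A k = A ↔ Fin k

module Submission where

-- A partition λ of n is recorded by its largest part m and the
-- partition μ = λ without λ₁, whose parts are all ≤ m.  More generally let
-- Framed j o n be the set of pairs (m, μ) with every part of μ at most m and
-- |μ| + j·m + o = n; its generating function is q^o Σₘ q^(jm)/(q;q)ₘ.
--  * p(n − o) counts Framed 1 o n (o ≥ 0; both sides vanish when o > n).
--  * Looking at whether μ has a part equal to m gives the recurrence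
--      Framed j o n  ≅  Framed (j+1) o n ⊎ Framed j (o+j) n.
--  * Writing λ₁ = 3m + r with r < 3, the condition λ₁ ≥ 3λ₂ says that all
--    parts of μ are ≤ m, so p⁽³⁾(n) counts Framed 3 0 n ⊎ Framed 3 1 n ⊎ Framed 3 2 n.
-- Unfolding the recurrence, both P3(n) ⊎ P(n−2) ⊎ P(n−3) and P(n) ⊎ P(n−5)
-- decompose into the same seven Framed sets; hence they are in bijection,
-- which gives p⁽³⁾(n) + p(n−2) + p(n−3) = p(n) + p(n−5).  The identity holds
-- for n = 0 as well.

open import Defs
open import Level using (0ℓ)
open import Data.Nat using (ℕ; zero; suc; _+_; _*_; _∸_; _≤_; _<_; _≥_; _≤?_; z≤n; s≤s; s≤s⁻¹)
open import Data.Nat.Properties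
open import Data.Nat.ListAction using (sum)
open import Data.Nat.Tactic.RingSolver using (solve-∀)
open import Data.Integer using (+_; -_; -[1+_]; _-_) renaming (_+_ to _+ℤ_)
import Data.Integer.Properties as ℤ
import Data.Integer.Tactic.RingSolver as ℤSolver
open import Data.List using (List; []; _∷_)
open import Data.List.Relation.Unary.All as All using (All; []; _∷_)
open import Data.List.Relation.Unary.Linked using (Linked; []; [-]; _∷_)
open import Data.Unit using (⊤; tt)
open import Data.Empty using (⊥-elim)
open import Data.Product using (Σ; _×_; _,_; proj₁)
open import Data.Sum using (_⊎_; inj₁; inj₂)
open import Function using (_∘′_)
open import Data.Sum.Algebra using (⊎-cong; ⊎-commutativeMonoid)
open import Data.Fin.Properties using (+↔⊎)
open import Data.Fin.Permutation using (↔⇒≡)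
open import Function.Bundles using (_↔_; mk↔ₛ′)
open import Function.Properties.Inverse using (↔-trans; ↔-sym; ↔-refl)
open import Relation.Nullary using (¬_; yes; no; Irrelevant)
open import Relation.Binary.PropositionalEquality

infixr 1 _⟫_
_⟫_ : ∀ {A B C : Set} → A ↔ B → B ↔ C → A ↔ C
_⟫_ = ↔-trans

subset-≡ : ∀ {A : Set} {B : A → Set} → (∀ x → Irrelevant (B x)) →
           {a a′ : A} {b : B a} {b′ : B a′} → a ≡ a′ → (a , b) ≡ (a′ , b′)
subset-≡ irr {b = b} {b′} refl = cong (_ ,_) (irr _ b b′)

empty↔empty : ∀ {A B : Set} → ¬ A → ¬ B → A ↔ B
empty↔empty ¬a ¬b = mk↔ₛ′ (λ a → ⊥-elim (¬a a)) (λ b → ⊥-elim (¬b b))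
                         (λ b → ⊥-elim (¬b b)) (λ a → ⊥-elim (¬a a))

Capped : ℕ → List ℕ → Set
Capped m []       = ⊤
Capped m (x ∷ xs) = 0 < x × x ≤ m × Capped x xs

capped-irrelevant : ∀ m l → Irrelevant (Capped m l)
capped-irrelevant m []      tt tt = refl
capped-irrelevant m (x ∷ l) (p , q , c) (p′ , q′ , c′)
  rewrite ≤-irrelevant p p′ | ≤-irrelevant q q′ | capped-irrelevant x l c c′ = refl

capped-weaken : ∀ {m m′} l → m ≤ m′ → Capped m l → Capped m′ l
capped-weaken []      _    tt          = tt
capped-weaken (x ∷ l) m≤m′ (p , q , c) = p , ≤-trans q m≤m′ , c

capped⇒positive : ∀ m l → Capped m l → All (0 <_) l
capped⇒positive m []      tt          = []
capped⇒positive m (x ∷ l) (p , _ , c) = p ∷ capped⇒positive x l c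

capped⇒decreasing : ∀ m l → Capped m l → Linked (λ a b → b ≤ a) (m ∷ l)
capped⇒decreasing m []      tt          = [-]
capped⇒decreasing m (x ∷ l) (_ , q , c) = q ∷ capped⇒decreasing x l c

decreasing⇒capped : ∀ m l → All (0 <_) l → Linked (λ a b → b ≤ a) (m ∷ l) → Capped m l
decreasing⇒capped m []      _       _         = tt
decreasing⇒capped m (x ∷ l) (p ∷ ps) (q ∷ dec) = p , q , decreasing⇒capped x l ps dec

linked-irrelevant : ∀ {R : ℕ → ℕ → Set} → (∀ x y → Irrelevant (R x y)) →
                    ∀ l → Irrelevant (Linked R l)
linked-irrelevant irr []          []       []         = refl
linked-irrelevant irr (x ∷ [])    [-]      [-]        = refl
linked-irrelevant irr (x ∷ y ∷ l) (r ∷ rs) (r′ ∷ rs′) =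
  cong₂ _∷_ (irr x y r r′) (linked-irrelevant irr (y ∷ l) rs rs′)

isPartition-irrelevant : ∀ n l → Irrelevant (IsPartition n l)
isPartition-irrelevant n l (p , d , e) (p′ , d′ , e′)
  rewrite All.irrelevant ≤-irrelevant p p′
        | linked-irrelevant (λ _ _ → ≤-irrelevant) l d d′
        | ≡-irrelevant e e′ = refl

first-irrelevant : ∀ l → Irrelevant (FirstAtLeastThreeTimesSecond l)
first-irrelevant []          _ _ = refl
first-irrelevant (a ∷ [])    _ _ = refl
first-irrelevant (a ∷ b ∷ l) p q = ≤-irrelevant p q

partition-≡ : ∀ {n} {p q : Partition n} → proj₁ p ≡ proj₁ q → p ≡ q
partition-≡ = subset-≡ (isPartition-irrelevant _)

partition3-≡ : ∀ {n} {p q : Partition3 n} → proj₁ p ≡ proj₁ q → p ≡ q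
partition3-≡ = subset-≡ λ l (i , f) (i′ , f′) →
  cong₂ _,_ (isPartition-irrelevant _ l i i′) (first-irrelevant l f f′)

Framed : ℕ → ℕ → ℕ → Set
Framed j o n = Σ ℕ λ m → Σ (List ℕ) λ l → Capped m l × (sum l + m * j + o ≡ n)

framed-≡ : ∀ {j o n m m′ l l′} {p : Capped m l × (sum l + m * j + o ≡ n)}
             {p′ : Capped m′ l′ × (sum l′ + m′ * j + o ≡ n)} →
           m ≡ m′ → l ≡ l′ → _≡_ {A = Framed j o n} (m , l , p) (m′ , l′ , p′)
framed-≡ refl l≡l′ = cong (_ ,_) (subset-≡ (λ l (c , e) (c′ , e′) →
  cong₂ _,_ (capped-irrelevant _ l c c′) (≡-irrelevant e e′)) l≡l′)

framed-offset≤ : ∀ {j o n} → Framed j o n → o ≤ n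
framed-offset≤ {j} {o} (m , l , _ , e) = subst (o ≤_) e (m≤n+m o (sum l + m * j))

-- Lowering the frame from 1+m to m moves j from the frame to the offset.
lower-frame : ∀ s j m o → s + suc m * j + o ≡ s + m * j + (o + j)
lower-frame = solve-∀

-- Removing a part equal to the frame 1+m raises the frame weight by one.
absorb-part : ∀ s j m o → suc m + s + suc m * j + o ≡ s + suc m * suc j + o
absorb-part = solve-∀

-- Framed j o n ≅ Framed (j+1) o n ⊎ Framed j (o+j) n: a pair (1+m, μ) either
-- has a part equal to 1+m, which is absorbed into the frame, or is capped by
-- m, in which case the frame is lowered.
module FrameRecurrence (j o n : ℕ) where
  Split : Set
  Split = Framed (suc j) o n ⊎ Framed j (o + j) n

  byTopPart : ∀ m x t → 0 < x → Capped x t → x + sum t + suc m * j + o ≡ n →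
              x < suc m ⊎ x ≡ suc m → Split
  byTopPart m x t x>0 c e (inj₁ x≤m) =
    inj₂ (m , x ∷ t , (x>0 , s≤s⁻¹ x≤m , c) , trans (sym (lower-frame (x + sum t) j m o)) e)
  byTopPart m .(suc m) t _ c e (inj₂ refl) =
    inj₁ (suc m , t , c , trans (sym (absorb-part (sum t) j m o)) e)

  to : Framed j o n → Split
  to (zero  , []    , tt , e)               = inj₁ (zero , [] , tt , e)
  to (zero  , x ∷ t , (s≤s _ , () , _) , _)
  to (suc m , []    , tt , e)               = inj₂ (m , [] , tt , trans (sym (lower-frame 0 j m o)) e)
  to (suc m , x ∷ t , (x>0 , x≤1+m , c) , e) = byTopPart m x t x>0 c e (m≤n⇒m<n∨m≡n x≤1+m)

  from : Split → Framed j o n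
  from (inj₁ (zero  , []    , tt , e))               = zero , [] , tt , e
  from (inj₁ (zero  , x ∷ t , (s≤s _ , () , _) , _))
  from (inj₁ (suc m , t , c , e)) =
    suc m , suc m ∷ t , (s≤s z≤n , ≤-refl , c) , trans (absorb-part (sum t) j m o) e
  from (inj₂ (m , l , c , e)) =
    suc m , l , capped-weaken l (n≤1+n m) c , trans (lower-frame (sum l) j m o) e

  from-byTopPart : ∀ m x t x>0 x≤1+m c e s →
    from (byTopPart m x t x>0 c e s) ≡ (suc m , x ∷ t , (x>0 , x≤1+m , c) , e)
  from-byTopPart m x t _ _ c e (inj₁ _) = framed-≡ refl refl
  from-byTopPart m .(suc m) t _ _ c e (inj₂ refl) = framed-≡ refl refl

  from∘to : ∀ f → from (to f) ≡ f
  from∘to (zero  , []    , tt , e)               = refl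
  from∘to (zero  , x ∷ t , (s≤s _ , () , _) , _)
  from∘to (suc m , []    , tt , e)               = framed-≡ refl refl
  from∘to (suc m , x ∷ t , (x>0 , x≤1+m , c) , e) =
    from-byTopPart m x t x>0 x≤1+m c e (m≤n⇒m<n∨m≡n x≤1+m)

  to∘from : ∀ s → to (from s) ≡ s
  to∘from (inj₁ (zero , [] , tt , e))                = refl
  to∘from (inj₁ (zero , x ∷ t , (s≤s _ , () , _) , _))
  to∘from (inj₁ (suc m , t , c , e)) with m≤n⇒m<n∨m≡n (≤-refl {suc m})
  ... | inj₁ m<m  = ⊥-elim (1+n≰n (s≤s⁻¹ m<m))
  ... | inj₂ refl = cong inj₁ (framed-≡ refl refl)
  to∘from (inj₂ (m , []    , tt , e))            = cong inj₂ (framed-≡ refl refl)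
  to∘from (inj₂ (m , x ∷ t , (x>0 , x≤m , c) , e))
    with m≤n⇒m<n∨m≡n (≤-trans x≤m (n≤1+n m))
  ... | inj₁ _    = cong inj₂ (framed-≡ refl refl)
  ... | inj₂ refl = ⊥-elim (1+n≰n x≤m)

  recurrence : Framed j o n ↔ Split
  recurrence = mk↔ₛ′ to from to∘from from∘to

open FrameRecurrence using (recurrence)

head-weight₁ : ∀ s m o → s + m * 1 + o ≡ m + s + o
head-weight₁ = solve-∀

partition↔framed : ∀ {k o n} → k + o ≡ n → Partition k ↔ Framed 1 o n
partition↔framed {k} {o} {n} k+o≡n = mk↔ₛ′ to from to∘from from∘to
  where
  weight : ∀ {s} → s ≡ k → s + o ≡ n
  weight s≡k = trans (cong (_+ o) s≡k) k+o≡n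

  size : ∀ {s} → s + o ≡ n → s ≡ k
  size {s} e = +-cancelʳ-≡ o s k (trans e (sym k+o≡n))

  to : Partition k → Framed 1 o n
  to ([]    , _ , _ , e)          = zero , [] , tt , weight e
  to (m ∷ l , _ ∷ pos , dec , e) =
    m , l , decreasing⇒capped m l pos dec , trans (head-weight₁ (sum l) m o) (weight e)

  from : Framed 1 o n → Partition k
  from (zero  , []    , tt , e)               = [] , [] , [] , size e
  from (zero  , x ∷ l , (s≤s _ , () , _) , _)
  from (suc m , l , c , e) =
    suc m ∷ l , s≤s z≤n ∷ capped⇒positive _ l c , capped⇒decreasing _ l c ,
    size (trans (sym (head-weight₁ (sum l) (suc m) o)) e)

  to∘from : ∀ f → to (from f) ≡ f
  to∘from (zero  , []    , tt , e)               = framed-≡ refl refl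
  to∘from (zero  , x ∷ l , (s≤s _ , () , _) , _)
  to∘from (suc m , l , c , e)                   = framed-≡ refl refl

  from∘to : ∀ p → from (to p) ≡ p
  from∘to ([]    , _ , _ , e)                 = partition-≡ refl
  from∘to (m ∷ l , s≤s z≤n ∷ pos , dec , e) = partition-≡ refl

difference-nonnegative : ∀ {n o} → o ≤ n → + n - + o ≡ + (n ∸ o)
difference-nonnegative {n} {o} o≤n = trans (ℤ.m-n≡m⊖n n o) (ℤ.⊖-≥ o≤n)

difference-negative : ∀ {n o} → n < o → Σ ℕ λ k → + n - + o ≡ -[1+ k ]
difference-negative {n} {suc o} (s≤s n≤o) =
  o ∸ n , trans (ℤ.m-n≡m⊖n n (suc o))
                (trans (ℤ.⊖-< (s≤s n≤o)) (cong (λ k → - + k) (+-∸-assoc 1 n≤o)))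

partitionℤ↔framed : ∀ n o → Partitionℤ (+ n - + o) ↔ Framed 1 o n
partitionℤ↔framed n o with o ≤? n
... | yes o≤n = subst (λ z → Partitionℤ z ↔ Framed 1 o n) (sym (difference-nonnegative o≤n))
                      (partition↔framed (m∸n+n≡m o≤n))
... | no o≰n with difference-negative (≰⇒> o≰n)
...   | k , eq = subst (λ z → Partitionℤ z ↔ Framed 1 o n) (sym eq)
                       (empty↔empty (λ ()) (λ f → o≰n (framed-offset≤ f)))

data Mod3 : ℕ → Set where
  rem0 : ∀ m → Mod3 (m * 3)
  rem1 : ∀ m → Mod3 (1 + m * 3)
  rem2 : ∀ m → Mod3 (2 + m * 3)

mod3 : ∀ a → Mod3 a
mod3 zero    = rem0 0
mod3 (suc a) with mod3 a
... | rem0 m = rem1 m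
... | rem1 m = rem2 m
... | rem2 m = rem0 (suc m)

mod3-rem0 : ∀ m → mod3 (m * 3) ≡ rem0 m
mod3-rem0 zero    = refl
mod3-rem0 (suc m) rewrite mod3-rem0 m = refl

mod3-rem1 : ∀ m → mod3 (1 + m * 3) ≡ rem1 m
mod3-rem1 m rewrite mod3-rem0 m = refl

mod3-rem2 : ∀ m → mod3 (2 + m * 3) ≡ rem2 m
mod3-rem2 m rewrite mod3-rem0 m = refl

third-bound : ∀ {y m r} → r ≤ 2 → 3 * y ≤ r + m * 3 → y ≤ m
third-bound {y} {m} {r} r≤2 3y≤a = s≤s⁻¹ (*-cancelˡ-< 3 y (suc m) (begin-strict
  3 * y       ≤⟨ 3y≤a ⟩
  r + m * 3   ≤⟨ +-monoˡ-≤ (m * 3) r≤2 ⟩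
  2 + m * 3   <⟨ n<1+n (2 + m * 3) ⟩
  suc m * 3   ≡⟨ *-comm (suc m) 3 ⟩
  3 * suc m   ∎))
  where open ≤-Reasoning

capped-by-third : ∀ {m r} t → r ≤ 2 → Capped (r + m * 3) t →
                  FirstAtLeastThreeTimesSecond (r + m * 3 ∷ t) → Capped m t
capped-by-third []      _   _           _    = tt
capped-by-third (y ∷ t) r≤2 (y>0 , _ , c) 3y≤a = y>0 , third-bound r≤2 3y≤a , c

third-capped⇒first : ∀ {m a} t → m * 3 ≤ a → Capped m t → FirstAtLeastThreeTimesSecond (a ∷ t)
third-capped⇒first []      _      _             = tt
third-capped⇒first {m} (y ∷ t) 3m≤a (_ , y≤m , _) =
  ≤-trans (subst (3 * y ≤_) (*-comm 3 m) (*-monoʳ-≤ 3 y≤m)) 3m≤a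

head-weight₃ : ∀ s q r → s + q + r ≡ r + q + s
head-weight₃ = solve-∀

-- p⁽³⁾(n) counts Framed 3 0 n ⊎ Framed 3 1 n ⊎ Framed 3 2 n: write λ₁ = 3m + r;
-- the empty partition corresponds to m = r = 0.
module Partition3AsFramed (n : ℕ) where
  Residues : Set
  Residues = Framed 3 0 n ⊎ (Framed 3 1 n ⊎ Framed 3 2 n)

  byResidue : ∀ a t → Capped a t → FirstAtLeastThreeTimesSecond (a ∷ t) →
              a + sum t ≡ n → Mod3 a → Residues
  byResidue _ t c f e (rem0 m) =
    inj₁ (m , t , capped-by-third t z≤n c f , trans (head-weight₃ (sum t) (m * 3) 0) e)
  byResidue _ t c f e (rem1 m) =
    inj₂ (inj₁ (m , t , capped-by-third t (s≤s z≤n) c f , trans (head-weight₃ (sum t) (m * 3) 1) e))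
  byResidue _ t c f e (rem2 m) =
    inj₂ (inj₂ (m , t , capped-by-third t (s≤s (s≤s z≤n)) c f , trans (head-weight₃ (sum t) (m * 3) 2) e))

  to : Partition3 n → Residues
  to ([]    , (_ , _ , e) , _)           = inj₁ (zero , [] , tt , e)
  to (a ∷ t , (_ ∷ pos , dec , e) , f) = byResidue a t (decreasing⇒capped a t pos dec) f e (mod3 a)

  attach : ∀ r m t → 0 < r + m * 3 → Capped m t → sum t + m * 3 + r ≡ n → Partition3 n
  attach r m t a>0 c e =
    r + m * 3 ∷ t , (a>0 ∷ capped⇒positive _ t c′ , capped⇒decreasing _ t c′ ,
                     trans (sym (head-weight₃ (sum t) (m * 3) r)) e) ,
    third-capped⇒first t (m≤n+m (m * 3) r) c
    where c′ = capped-weaken t (≤-trans (m≤m*n m 3) (m≤n+m (m * 3) r)) c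

  from : Residues → Partition3 n
  from (inj₁ (zero  , []    , tt , e))               = [] , ([] , [] , e) , tt
  from (inj₁ (zero  , x ∷ t , (s≤s _ , () , _) , _))
  from (inj₁ (suc m , t , c , e))        = attach 0 (suc m) t (s≤s z≤n) c e
  from (inj₂ (inj₁ (m , t , c , e)))     = attach 1 m t (s≤s z≤n) c e
  from (inj₂ (inj₂ (m , t , c , e)))     = attach 2 m t (s≤s z≤n) c e

  from-byResidue : ∀ a t a>0 pos dec f e v →
    from (byResidue a t (decreasing⇒capped a t pos dec) f e v) ≡ (a ∷ t , (a>0 ∷ pos , dec , e) , f)
  from-byResidue _ t () pos dec f e (rem0 zero)
  from-byResidue _ t a>0 pos dec f e (rem0 (suc m)) = partition3-≡ refl
  from-byResidue _ t a>0 pos dec f e (rem1 m)       = partition3-≡ refl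
  from-byResidue _ t a>0 pos dec f e (rem2 m)       = partition3-≡ refl

  from∘to : ∀ p → from (to p) ≡ p
  from∘to ([]    , (_ , _ , e) , _)           = partition3-≡ refl
  from∘to (a ∷ t , (a>0 ∷ pos , dec , e) , f) = from-byResidue a t a>0 pos dec f e (mod3 a)

  to∘from : ∀ r → to (from r) ≡ r
  to∘from (inj₁ (zero  , []    , tt , e))               = refl
  to∘from (inj₁ (zero  , x ∷ t , (s≤s _ , () , _) , _))
  to∘from (inj₁ (suc m , t , c , e)) rewrite mod3-rem0 (suc m) = cong inj₁ (framed-≡ refl refl)
  to∘from (inj₂ (inj₁ (m , t , c , e))) rewrite mod3-rem1 m = cong (inj₂ ∘′ inj₁) (framed-≡ refl refl)
  to∘from (inj₂ (inj₂ (m , t , c , e))) rewrite mod3-rem2 m = cong (inj₂ ∘′ inj₂) (framed-≡ refl refl)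

  partition3↔framed : Partition3 n ↔ Residues
  partition3↔framed = mk↔ₛ′ to from to∘from from∘to

open Partition3AsFramed using (partition3↔framed)

module Decompositions (n : ℕ) where
  F : ℕ → ℕ → Set
  F j o = Framed j o n

  -- P3(n) ⊎ P(n−2) ⊎ P(n−3) ≅ (F₃₀ ⊎ F₃₁ ⊎ F₃₂) ⊎ F₁₂ ⊎ F₂₃ ⊎ F₂₄ ⊎ F₁₅,
  -- using F₁₃ ≅ F₂₃ ⊎ F₁₄ and F₁₄ ≅ F₂₄ ⊎ F₁₅.
  restricted-side :
    (Partition3 n ⊎ (Partitionℤ (+ n - + 2) ⊎ Partitionℤ (+ n - + 3))) ↔
    ((F 3 0 ⊎ (F 3 1 ⊎ F 3 2)) ⊎ (F 1 2 ⊎ (F 2 3 ⊎ (F 2 4 ⊎ F 1 5))))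
  restricted-side =
    ⊎-cong (partition3↔framed n)
      (⊎-cong (partitionℤ↔framed n 2)
              (partitionℤ↔framed n 3 ⟫ recurrence 1 3 n ⟫ ⊎-cong ↔-refl (recurrence 1 4 n)))

  -- P(n) ⊎ P(n−5) ≅ ((F₃₀ ⊎ F₃₂ ⊎ F₂₄) ⊎ (F₃₁ ⊎ F₂₃) ⊎ F₁₂) ⊎ F₁₅, unfolding
  -- F₁₀ ≅ F₂₀ ⊎ F₁₁, F₂₀ ≅ F₃₀ ⊎ F₂₂, F₂₂ ≅ F₃₂ ⊎ F₂₄, F₁₁ ≅ F₂₁ ⊎ F₁₂, F₂₁ ≅ F₃₁ ⊎ F₂₃.
  unrestricted-side :
    (Partitionℤ (+ n) ⊎ Partitionℤ (+ n - + 5)) ↔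
    (((F 3 0 ⊎ (F 3 2 ⊎ F 2 4)) ⊎ ((F 3 1 ⊎ F 2 3) ⊎ F 1 2)) ⊎ F 1 5)
  unrestricted-side = ⊎-cong unfold-p (partitionℤ↔framed n 5)
    where
    unfold-p : Partition n ↔ ((F 3 0 ⊎ (F 3 2 ⊎ F 2 4)) ⊎ ((F 3 1 ⊎ F 2 3) ⊎ F 1 2))
    unfold-p = partition↔framed (+-identityʳ n) ⟫ recurrence 1 0 n ⟫
      ⊎-cong (recurrence 2 0 n ⟫ ⊎-cong ↔-refl (recurrence 2 2 n))
             (recurrence 1 1 n ⟫ ⊎-cong (recurrence 2 1 n) ↔-refl)

regroup : ∀ (A B C D E F G : Set) →
  ((A ⊎ (B ⊎ C)) ⊎ (E ⊎ (F ⊎ (D ⊎ G)))) ↔ (((A ⊎ (C ⊎ D)) ⊎ ((B ⊎ F) ⊎ E)) ⊎ G)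
regroup A B C D E F G =
  prove 7 ((a ⊕ (b ⊕ c)) ⊕ (e ⊕ (f ⊕ (d ⊕ g)))) (((a ⊕ (c ⊕ d)) ⊕ ((b ⊕ f) ⊕ e)) ⊕ g)
          (A ∷ B ∷ C ∷ D ∷ E ∷ F ∷ G ∷ [])
  where
  open import Algebra.Solver.CommutativeMonoid (⊎-commutativeMonoid 0ℓ)
  open import Data.Fin using (zero; suc)
  open import Data.Vec using ([]; _∷_)
  a = var zero
  b = var (suc zero)
  c = var (suc (suc zero))
  d = var (suc (suc (suc zero)))
  e = var (suc (suc (suc (suc zero))))
  f = var (suc (suc (suc (suc (suc zero)))))
  g = var (suc (suc (suc (suc (suc (suc zero))))))

partition3-bijection : ∀ n →
  (Partition3 n ⊎ (Partitionℤ (+ n - + 2) ⊎ Partitionℤ (+ n - + 3))) ↔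
  (Partitionℤ (+ n) ⊎ Partitionℤ (+ n - + 5))
partition3-bijection n = restricted-side ⟫ regroup _ _ _ _ _ _ _ ⟫ ↔-sym unrestricted-side
  where open Decompositions n

card-⊎ : ∀ {A B : Set} {a b : ℕ} → HasCard A a → HasCard B b → HasCard (A ⊎ B) (a + b)
card-⊎ hA hB = ⊎-cong hA hB ⟫ ↔-sym +↔⊎

card-unique : ∀ {A B : Set} {a b : ℕ} → HasCard A a → HasCard B b → A ↔ B → a ≡ b
card-unique hA hB π = ↔⇒≡ (↔-sym hA ⟫ π ⟫ hB)

solve-for-e : ∀ a b c d e → e + (b + c) ≡ a + d → + e ≡ + a - + b - + c +ℤ + d
solve-for-e a b c d e eq = begin
  + e                             ≡⟨ cancel (+ e) (+ b) (+ c) ⟩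
  + e +ℤ (+ b +ℤ + c) - + b - + c ≡⟨ cong (λ z → + z - + b - + c) eq ⟩
  + a +ℤ + d - + b - + c          ≡⟨ reorder (+ a) (+ d) (+ b) (+ c) ⟩
  + a - + b - + c +ℤ + d          ∎
  where
  open ≡-Reasoning
  cancel : ∀ x y z → x ≡ x +ℤ (y +ℤ z) - y - z
  cancel = ℤSolver.solve-∀
  reorder : ∀ x w y z → x +ℤ w - y - z ≡ x - y - z +ℤ w
  reorder = ℤSolver.solve-∀

corollary3 : (n : ℕ) → n ≥ 1 →
    (a b c d e : ℕ) →
    HasCard (Partition3 n) e →
    HasCard (Partitionℤ (+ n)) a →
    HasCard (Partitionℤ (+ n - + 2)) b →
    HasCard (Partitionℤ (+ n - + 3)) c →
    HasCard (Partitionℤ (+ n - + 5)) d →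
    + e ≡ + a - + b - + c +ℤ + d
corollary3 n _ a b c d e hE hA hB hC hD =
  solve-for-e a b c d e
    (card-unique (card-⊎ hE (card-⊎ hB hC)) (card-⊎ hA hD) (partition3-bijection n))
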